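{- There is a single Hopf algebra morphism $\Phi:\overline\Lambda\to\overline{\widetilde\Lambda}$ such that $\Phi(\overline X_G)=\overline X_{\overline G}$ for every unweighted triangle-free graph $G$.
   Context: Work over a field $\mathbb{K}$ of characteristic $0$. Unweighted graph: finite simple graph with all vertex weights $1$; triangle-free: no three pairwise adjacent vertices; $\overline G$ complement. $\overline X_G=\sum_\kappa\prod_v\prod_{i\in\kappa(v)}x_i$ over proper set colorings $\kappa$ (each vertex gets a nonempty set of positive integers, adjacent vertices get disjoint sets). $\overline\Lambda$ is the completion of the Hopf algebra of symmetric functions (symmetric power series of unbounded degree), with coproduct extended from $\Delta p_n=p_n\otimes1+1\otimes p_n$. $\overline{\widetilde\Lambda}$ is $\overline\Lambda$ with the same coproduct but product $\odot$ extending $\widetilde m_\lambda\odot\widetilde m_\mu=\widetilde m_{\lambda\sqcup\mu}$, where $\widetilde m_\lambda=m_\lambda\prod_ir_i(\lambda)!$ ($r_i(\lambda)$ multiplicity of $i$) and $\lambda\sqcup\mu$ is the union of parts. -}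

module Defs where

open import Level using (Level; _⊔_) renaming (suc to lsuc)
open import Data.Nat as ℕ using (ℕ; zero; suc; _∸_)
open import Data.Nat.Properties using (≤-decTotalOrder; ≤-totalOrder)
open import Data.Bool using (Bool; true; false; not; _∧_; _∨_; if_then_else_)
open import Data.List using (List; []; _∷_; map; _++_; concatMap; zipWith; filter; length; foldr; allFin; mapMaybe)
open import Data.Bool.ListAction using (all; any)
open import Data.Maybe using (Maybe; just; nothing)
open import Data.Product using (Σ; _×_; _,_; proj₁; proj₂)
open import Data.Fin using (Fin)
open import Data.Fin.Properties using (_≟_)
open import Data.Vec using (Vec; lookup; toList; []; _∷_)
open import Data.Empty using (⊥; ⊥-elim)
open import Data.Bool.Properties using (∧-zeroʳ)
open import Data.Fin.Subset using (Subset)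
open import Relation.Nullary using (¬_; yes; no)
open import Relation.Nullary.Decidable using (⌊_⌋)
open import Relation.Binary.PropositionalEquality using (_≡_; refl; sym)
open import Algebra.Bundles using (CommutativeRing)
open import Data.List.Relation.Unary.Sorted.TotalOrder ≤-totalOrder using (Sorted)
open import Data.List.Sort.Base using (SortingAlgorithm)
open import Data.List.Sort.MergeSort ≤-decTotalOrder using (mergeSort)
open SortingAlgorithm mergeSort using (sort; sort-↗)

ringFromℕ : {c ℓ : Level} (R : CommutativeRing c ℓ) → ℕ → CommutativeRing.Carrier R
ringFromℕ R zero    = CommutativeRing.0# R
ringFromℕ R (suc n) = CommutativeRing._+_ R (CommutativeRing.1# R) (ringFromℕ R n)

record CharZeroField (c ℓ : Level) : Set (lsuc (c ⊔ ℓ)) where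
  field
    commRing : CommutativeRing c ℓ
  open CommutativeRing commRing public
  field
    1≉0       : ¬ (1# ≈ 0#)
    _⁻¹       : (x : Carrier) → ¬ (x ≈ 0#) → Carrier
    inverseˡ  : (x : Carrier) (x≉0 : ¬ (x ≈ 0#)) → ((x ⁻¹) x≉0) * x ≈ 1#
    charZero  : (n : ℕ) → ¬ (ringFromℕ commRing (suc n) ≈ 0#)

-- A partition is stored as a weakly increasing list
-- [a₁ , … , aₗ] of natural numbers, the part aᵢ standing for the
-- positive integer aᵢ + 1.  (Thus every list entry gives a positive part.)

record Partition : Set where
  constructor mkPartition
  field
    codes  : List ℕ
    sorted : Sorted codes

open Partition public

parts : Partition → List ℕ
parts λ' = map suc (codes λ')

toPartition : List ℕ → Partition
toPartition xs = mkPartition (sort ys) (sort-↗ ys)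
  where
  pred? : ℕ → Maybe ℕ
  pred? zero    = nothing
  pred? (suc k) = just k
  ys = mapMaybe pred? xs

emptyPartition : Partition
emptyPartition = toPartition []

isEmpty : Partition → Bool
isEmpty λ' with codes λ'
... | []    = true
... | _ ∷ _ = false

_⊔ₚ_ : Partition → Partition → Partition
λ' ⊔ₚ μ = toPartition (parts λ' ++ parts μ)

range : ℕ → List ℕ
range zero    = zero ∷ []
range (suc n) = zero ∷ map suc (range n)

boxes : List ℕ → List (List ℕ)
boxes []       = [] ∷ []
boxes (x ∷ xs) = concatMap (λ a → map (a ∷_) (boxes xs)) (range x)

splits : {A : Set} → List A → List (List A × List A)
splits []       = ([] , []) ∷ []
splits (x ∷ xs) =
  concatMap (λ p → ((x ∷ proj₁ p) , proj₂ p) ∷ (proj₁ p , (x ∷ proj₂ p)) ∷ []) (splits xs)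

-- An element f of Λ̄ (or of Λ̄~, which has the same underlying space and
-- the same coproduct) is the symmetric power series  Σ_λ f(λ) m_λ ,
-- an arbitrary function from partitions to the field.

module SymFun {c ℓ : Level} (K : CharZeroField c ℓ) where
  open CharZeroField K

  Sym : Set c
  Sym = Partition → Carrier

  -- the completed tensor product Λ̄ ⊗̂ Λ̄, coordinates w.r.t. m_μ ⊗ m_ν
  Sym² : Set c
  Sym² = Partition → Partition → Carrier

  Σ[_] : List Carrier → Carrier
  Σ[ xs ] = foldr _+_ 0# xs

  _≐_ : Sym → Sym → Set ℓ
  f ≐ g = ∀ λ' → f λ' ≈ g λ'

  _≐²_ : Sym² → Sym² → Set ℓ
  F ≐² G = ∀ μ ν → F μ ν ≈ G μ ν

  one : Sym
  one λ' = if isEmpty λ' then 1# else 0#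

  -- ordinary product of Λ̄: the coefficient of x₁^{λ₁}⋯x_ℓ^{λ_ℓ} in f·g
  -- is Σ_{α+β=λ} f(sort α) g(sort β)
  _·_ : Sym → Sym → Sym
  (f · g) λ' = Σ[ map (λ α → f (toPartition α) * g (toPartition (zipWith _∸_ (parts λ') α)))
                      (boxes (parts λ')) ]

  -- the product ⊙ of Λ̄~, determined by m̃_μ ⊙ m̃_ν = m̃_{μ⊔ν} where
  -- m̃_λ = m_λ ∏ᵢ rᵢ(λ)! .  In m-coordinates:
  -- (f ⊙ g)(λ) = Σ_{μ⊔ν=λ} ∏ᵢ binom(rᵢ(λ), rᵢ(μ)) f(μ) g(ν)
  --            = Σ over splittings of the positions of λ into (A , B) of f(A) g(B)
  _⊙_ : Sym → Sym → Sym
  (f ⊙ g) λ' = Σ[ map (λ p → f (toPartition (proj₁ p)) * g (toPartition (proj₂ p)))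
                      (splits (parts λ')) ]

  -- coproduct (common to both): Δ m_λ = Σ_{μ⊔ν=λ} m_μ ⊗ m_ν
  Δ : Sym → Sym²
  Δ f μ ν = f (μ ⊔ₚ ν)

  ε : Sym → Carrier
  ε f = f emptyPartition

  -- A continuous K-linear map Λ̄ → Λ̄~ : each output coefficient is a finite
  -- linear combination of input coefficients (row-finite matrix).
  record ContLinMap : Set c where
    field
      row : Partition → List (Partition × Carrier)

    apply : Sym → Sym
    apply f μ = Σ[ map (λ p → proj₂ p * f (proj₁ p)) (row μ) ]

    apply² : Sym² → Sym²
    apply² F μ ν = Σ[ concatMap (λ p → map (λ q → (proj₂ p * proj₂ q) * F (proj₁ p) (proj₁ q)) (row ν)) (row μ) ]

  open ContLinMap public

  record IsHopfMorphism (Φ : ContLinMap) : Set (c ⊔ ℓ) where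
    field
      preserves-· : ∀ f g → apply Φ (f · g) ≐ (apply Φ f ⊙ apply Φ g)
      preserves-1 : apply Φ one ≐ one
      preserves-Δ : ∀ f → Δ (apply Φ f) ≐² apply² Φ (Δ f)
      preserves-ε : ∀ f → ε (apply Φ f) ≈ ε f

record Graph : Set where
  field
    n         : ℕ
    adj       : Fin n → Fin n → Bool
    adj-sym   : ∀ i j → adj i j ≡ adj j i
    adj-irrefl : ∀ i → adj i i ≡ false

open Graph public

TriangleFree : Graph → Set
TriangleFree G = ∀ i j k → adj G i j ≡ true → adj G j k ≡ true → adj G i k ≡ true → ⊥

complement : Graph → Graph
complement G = record
  { n          = n G
  ; adj        = λ i j → not (adj G i j) ∧ not ⌊ i ≟ j ⌋
  ; adj-sym    = λ i j → sym-lemma i j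
  ; adj-irrefl = λ i → irr-lemma i
  }
  where
  ≟-sym : ∀ (i j : Fin (n G)) → ⌊ i ≟ j ⌋ ≡ ⌊ j ≟ i ⌋
  ≟-sym i j with i ≟ j | j ≟ i
  ... | yes _ | yes _ = refl
  ... | no _  | no _  = refl
  ... | yes p | no q  = ⊥-elim (q (sym p))
  ... | no p  | yes q = ⊥-elim (p (sym q))
  sym-lemma : ∀ i j → not (adj G i j) ∧ not ⌊ i ≟ j ⌋ ≡ not (adj G j i) ∧ not ⌊ j ≟ i ⌋
  sym-lemma i j rewrite adj-sym G i j | ≟-sym i j = refl
  irr-lemma : ∀ i → not (adj G i i) ∧ not ⌊ i ≟ i ⌋ ≡ false
  irr-lemma i with i ≟ i
  ... | yes _ = ∧-zeroʳ (not (adj G i i))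
  ... | no ¬p = ⊥-elim (¬p refl)

-- A proper set coloring κ (each vertex gets a nonempty set of colours,
-- adjacent vertices disjoint sets) contributes the monomial
-- ∏_v ∏_{i∈κ(v)} xᵢ .  Hence the coefficient of m_λ (= that of
-- x₁^{λ₁}⋯x_ℓ^{λ_ℓ}) is the number of tuples (S₁,…,S_ℓ) of independent
-- sets with |Sᵢ| = λᵢ covering all vertices (Sᵢ = {v : i ∈ κ(v)}).

boolFilter : {A : Set} → (A → Bool) → List A → List A
boolFilter p []       = []
boolFilter p (x ∷ xs) = if p x then x ∷ boolFilter p xs else boolFilter p xs

allSubsets : (m : ℕ) → List (Subset m)
allSubsets zero    = [] ∷ []
allSubsets (suc m) = concatMap (λ S → (true ∷ S) ∷ (false ∷ S) ∷ []) (allSubsets m)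

isIndependent : (G : Graph) → Subset (n G) → Bool
isIndependent G S =
  all (λ i → all (λ j → not (lookup S i ∧ lookup S j ∧ adj G i j)) (allFin (n G))) (allFin (n G))

size : {m : ℕ} → Subset m → ℕ
size S = length (boolFilter (λ b → b) (toList S))

indepOfSize : (G : Graph) → ℕ → List (Subset (n G))
indepOfSize G k = boolFilter (λ S → isIndependent G S ∧ ⌊ size S ℕ.≟ k ⌋) (allSubsets (n G))

tuples : (G : Graph) → List ℕ → List (List (Subset (n G)))
tuples G []       = [] ∷ []
tuples G (k ∷ ks) = concatMap (λ S → map (S ∷_) (tuples G ks)) (indepOfSize G k)

covers : (G : Graph) → List (Subset (n G)) → Bool
covers G Ss = all (λ v → any (λ S → lookup S v) Ss) (allFin (n G))

setColoringCount : Graph → Partition → ℕ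
setColoringCount G λ' = length (boolFilter (covers G) (tuples G (parts λ')))

Xbar : {c ℓ : Level} (K : CharZeroField c ℓ) → Graph → SymFun.Sym K
Xbar K G λ' = ringFromℕ (CharZeroField.commRing K) (setColoringCount G λ')

-- Φ acts on the coefficients of a symmetric function part by part: (Φ f)(λ)
-- chooses, for every part of λ, one of finitely many weighted replacements by a
-- multiset of parts, and sums the product of the weights times f at the union of the
-- replacements.  Since both coproducts split a partition into two unions of parts,
-- any such Φ is a coalgebra map, and it turns · into ⊙ as soon as, for each part
-- size, the functional f ↦ (Φ f)((k)) is an ε-derivation.
--
-- The coefficient of m_λ in X̄_G counts tuples of independent sets of sizes λᵢ
-- covering the vertices, so Φ X̄_G = X̄_Ḡ follows once the replacement rule
-- rewrites independent sets of Ḡ of size k through independent sets of G.  For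
-- k = 1 nothing changes.  For k = 2 the independent sets of Ḡ are the edges of G:
-- all 2-sets, counted as ½ (ordered pairs of singletons − singletons), minus the
-- independent 2-sets of G.  For k ≥ 3 an independent set of Ḡ would be a triangle
-- of G.  With the same weights ½, −½, −1 the mixed terms m₁ ⊗ m₁ cancel, which is
-- the derivation property for k = 2.

module Submission where

open import Defs
open import Level using (Level; _⊔_)
open import Data.Nat using (ℕ; zero; suc; _∸_; _≡ᵇ_; _≟_)
open import Data.Nat.Properties using (suc-injective; ≡ᵇ⇒≡; ≤-irrelevant; ≤-totalOrder)
open import Data.Bool using (Bool; true; false; not; _∧_; _∨_; T)
open import Data.Bool.Properties using (∧-zeroʳ)
open import Data.Unit using (tt)
open import Data.Empty using (⊥-elim)
open import Data.Maybe using (Maybe; just; nothing)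
open import Data.Product using (Σ; ∃; ∃₂; _×_; _,_; proj₁; proj₂)
open import Data.Sum using (_⊎_; inj₁; inj₂)
open import Data.List using (List; []; _∷_; map; _++_; concatMap; foldr; length; zipWith; mapMaybe; allFin)
open import Data.List.Properties using (map-++; ++-assoc)
open import Data.List.Relation.Unary.All as All using (All; []; _∷_)
open import Data.List.Relation.Unary.Any using (here; there)
import Data.List.Relation.Unary.Linked as Linked
open import Data.List.Relation.Unary.Sorted.TotalOrder.Properties using (↗↭↗⇒≋)
open import Data.List.Relation.Binary.Pointwise using (Pointwise-≡⇒≡)
open import Data.List.Membership.Propositional using (_∈_)
open import Data.List.Membership.Propositional.Properties using (∈-allFin)
import Data.List.Relation.Binary.Permutation.Propositional as ↭
open ↭ using (_↭_)
open import Data.List.Relation.Binary.Permutation.Propositional.Properties using (map⁺; ++⁺; ++⁺ˡ; shifts; ↭-length)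
open import Data.List.Sort.Base using (SortingAlgorithm)
open import Data.List.Sort.MergeSort Data.Nat.Properties.≤-decTotalOrder using (mergeSort)
open import Data.Vec using ([]; _∷_; lookup)
open import Data.Vec.Properties using (lookup-replicate; lookup-zipWith)
open import Data.Fin using (Fin) renaming (zero to fzero; suc to fsuc)
import Data.Fin.Properties as Fin
open import Data.Fin.Subset using (Subset; ⊥; _∪_; ⋃)
open import Data.Fin.Subset.Properties using (∪-identityˡ; ∪-identityʳ; ∪-assoc; ∪-commutativeMonoid)
open import Function using (_∘_)
open import Algebra.Bundles using (CommutativeMonoid; CommutativeRing)
open import Relation.Binary.Bundles using (TotalOrder)
open import Relation.Nullary using (yes; no)
open import Relation.Nullary.Decidable using (isYes≗does)
import Relation.Binary.PropositionalEquality as ≡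
open ≡ using (_≡_; _≢_)

open SortingAlgorithm mergeSort using (sort-↭)

module PartitionCodes where

  open ≡ using (refl; cong; cong₂; sym)
  open ↭ using (refl; prep; swap; trans; ↭-trans; ↭-reflexive; ↭-sym; ↭⇒↭ₛ′; module PermutationReasoning)

  nonzeroCodes : List ℕ → List ℕ
  nonzeroCodes []           = []
  nonzeroCodes (zero  ∷ xs) = nonzeroCodes xs
  nonzeroCodes (suc k ∷ xs) = k ∷ nonzeroCodes xs

  nonzeroCodes-++ : ∀ xs ys → nonzeroCodes (xs ++ ys) ≡ nonzeroCodes xs ++ nonzeroCodes ys
  nonzeroCodes-++ []           ys = refl
  nonzeroCodes-++ (zero  ∷ xs) ys = nonzeroCodes-++ xs ys
  nonzeroCodes-++ (suc k ∷ xs) ys = cong (k ∷_) (nonzeroCodes-++ xs ys)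

  nonzeroCodes-map-suc : ∀ xs → nonzeroCodes (map suc xs) ≡ xs
  nonzeroCodes-map-suc []       = refl
  nonzeroCodes-map-suc (x ∷ xs) = cong (x ∷_) (nonzeroCodes-map-suc xs)

  nonzeroCodes-↭ : ∀ {xs ys} → xs ↭ ys → nonzeroCodes xs ↭ nonzeroCodes ys
  nonzeroCodes-↭ refl                    = refl
  nonzeroCodes-↭ (prep zero p)           = nonzeroCodes-↭ p
  nonzeroCodes-↭ (prep (suc x) p)        = prep x (nonzeroCodes-↭ p)
  nonzeroCodes-↭ (swap zero zero p)      = nonzeroCodes-↭ p
  nonzeroCodes-↭ (swap zero (suc y) p)   = prep y (nonzeroCodes-↭ p)
  nonzeroCodes-↭ (swap (suc x) zero p)   = prep x (nonzeroCodes-↭ p)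
  nonzeroCodes-↭ (swap (suc x) (suc y) p) = swap x y (nonzeroCodes-↭ p)
  nonzeroCodes-↭ (trans p q)             = trans (nonzeroCodes-↭ p) (nonzeroCodes-↭ q)

  mapMaybe≡nonzeroCodes : (p : ℕ → Maybe ℕ) → p zero ≡ nothing → (∀ k → p (suc k) ≡ just k) →
                          ∀ xs → mapMaybe p xs ≡ nonzeroCodes xs
  mapMaybe≡nonzeroCodes p p0 ps []           = refl
  mapMaybe≡nonzeroCodes p p0 ps (zero  ∷ xs) rewrite p0   = mapMaybe≡nonzeroCodes p p0 ps xs
  mapMaybe≡nonzeroCodes p p0 ps (suc k ∷ xs) rewrite ps k = cong (k ∷_) (mapMaybe≡nonzeroCodes p p0 ps xs)

  codes-toPartition : ∀ xs → codes (toPartition xs) ↭ nonzeroCodes xs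
  codes-toPartition xs = ↭-trans (sort-↭ _) (↭-reflexive (mapMaybe≡nonzeroCodes _ refl (λ _ → refl) xs))

  parts-toPartition : ∀ xs → parts (toPartition xs) ↭ map suc (nonzeroCodes xs)
  parts-toPartition xs = map⁺ suc (codes-toPartition xs)

  codes-injective : ∀ {p q} → codes p ≡ codes q → p ≡ q
  codes-injective {mkPartition c s} {mkPartition .c s′} refl =
    cong (mkPartition c) (Linked.irrelevant ≤-irrelevant s s′)

  ↭-codes⇒≡ : ∀ p q → codes p ↭ codes q → p ≡ q
  ↭-codes⇒≡ p q h = codes-injective (Pointwise-≡⇒≡
    (↗↭↗⇒≋ ≤-totalOrder (sorted p) (sorted q) (↭⇒↭ₛ′ (TotalOrder.Eq.isEquivalence ≤-totalOrder) h)))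

  toPartition-cong : ∀ xs ys → nonzeroCodes xs ↭ nonzeroCodes ys → toPartition xs ≡ toPartition ys
  toPartition-cong xs ys h =
    ↭-codes⇒≡ _ _ (↭-trans (codes-toPartition xs) (↭-trans h (↭-sym (codes-toPartition ys))))

  toPartition-++ : ∀ xs ys → toPartition xs ⊔ₚ toPartition ys ≡ toPartition (xs ++ ys)
  toPartition-++ xs ys = toPartition-cong (parts (toPartition xs) ++ parts (toPartition ys)) (xs ++ ys) (begin
    nonzeroCodes (parts (toPartition xs) ++ parts (toPartition ys))
      ≡⟨ nonzeroCodes-++ (parts (toPartition xs)) (parts (toPartition ys)) ⟩
    nonzeroCodes (parts (toPartition xs)) ++ nonzeroCodes (parts (toPartition ys))
      ≡⟨ cong₂ _++_ (nonzeroCodes-map-suc (codes (toPartition xs))) (nonzeroCodes-map-suc (codes (toPartition ys))) ⟩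
    codes (toPartition xs) ++ codes (toPartition ys)
      ↭⟨ ++⁺ (codes-toPartition xs) (codes-toPartition ys) ⟩
    nonzeroCodes xs ++ nonzeroCodes ys
      ≡⟨ sym (nonzeroCodes-++ xs ys) ⟩
    nonzeroCodes (xs ++ ys) ∎)
    where open PermutationReasoning

  nonzeroCodes-++⁺ : ∀ {xs xs′ ys ys′} → nonzeroCodes xs ↭ nonzeroCodes xs′ → nonzeroCodes ys ↭ nonzeroCodes ys′ →
                     nonzeroCodes (xs ++ ys) ↭ nonzeroCodes (xs′ ++ ys′)
  nonzeroCodes-++⁺ {xs} {xs′} {ys} {ys′} p q =
    ↭-trans (↭-reflexive (nonzeroCodes-++ xs ys)) (↭-trans (++⁺ p q) (↭-reflexive (sym (nonzeroCodes-++ xs′ ys′))))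

open PartitionCodes

module IndependentSets where

  open import Data.Bool.ListAction using (all; any)
  open import Algebra.Properties.CommutativeSemigroup using (x∙yz≈y∙xz)
  open import Data.Nat using (_+_)
  open ≡ using (refl; sym; cong; cong₂; subst; subst₂; module ≡-Reasoning) renaming (trans to ≡-trans)

  private variable
    m : ℕ

  all-true : ∀ {A : Set} (p : A → Bool) xs → (∀ x → p x ≡ true) → all p xs ≡ true
  all-true p []       h = refl
  all-true p (x ∷ xs) h rewrite h x = all-true p xs h

  all-true⇒∈ : ∀ {A : Set} (p : A → Bool) xs → all p xs ≡ true → ∀ {x} → x ∈ xs → p x ≡ true
  all-true⇒∈ p (y ∷ xs) e (here refl) with p y | e
  ... | true | _ = refl
  all-true⇒∈ p (y ∷ xs) e (there x∈xs) with p y | e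
  ... | true | e′ = all-true⇒∈ p xs e′ x∈xs

  all-cong : ∀ {A : Set} {p q : A → Bool} xs → (∀ x → p x ≡ q x) → all p xs ≡ all q xs
  all-cong []       h = refl
  all-cong (x ∷ xs) h = cong₂ _∧_ (h x) (all-cong xs h)

  isFull : Subset m → Bool
  isFull {m} W = all (lookup W) (allFin m)

  ⋃-++ : (Ss Ts : List (Subset m)) → ⋃ (Ss ++ Ts) ≡ ⋃ Ss ∪ ⋃ Ts
  ⋃-++ []       Ts = sym (∪-identityˡ (⋃ Ts))
  ⋃-++ (S ∷ Ss) Ts = ≡-trans (cong (S ∪_) (⋃-++ Ss Ts)) (sym (∪-assoc S (⋃ Ss) (⋃ Ts)))

  ⋃-↭ : {Ss Ts : List (Subset m)} → Ss ↭ Ts → ⋃ Ss ≡ ⋃ Ts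
  ⋃-↭ ↭.refl         = refl
  ⋃-↭ (↭.prep S p)   = cong (S ∪_) (⋃-↭ p)
  ⋃-↭ (↭.swap S T p) = ≡-trans (cong (λ W → S ∪ (T ∪ W)) (⋃-↭ p))
                       (x∙yz≈y∙xz (CommutativeMonoid.commutativeSemigroup (∪-commutativeMonoid _)) S T _)
  ⋃-↭ (↭.trans p q)  = ≡-trans (⋃-↭ p) (⋃-↭ q)

  any-lookup : (Ss : List (Subset m)) (v : Fin m) → any (λ S → lookup S v) Ss ≡ lookup (⋃ Ss) v
  any-lookup []       v = sym (lookup-replicate v false)
  any-lookup (S ∷ Ss) v = ≡-trans (cong (lookup S v ∨_) (any-lookup Ss v)) (sym (lookup-zipWith _∨_ v S (⋃ Ss)))

  covers≡isFull-⋃ : ∀ G Ss → covers G Ss ≡ isFull (⋃ Ss)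
  covers≡isFull-⋃ G Ss = all-cong (allFin (n G)) (any-lookup Ss)


  ofSize : ℕ → Subset m → Bool
  ofSize k S = size S ≡ᵇ k

  ofSize⇒size≡ : ∀ k (S : Subset m) → ofSize k S ≡ true → size S ≡ k
  ofSize⇒size≡ k S e = ≡ᵇ⇒≡ (size S) k (subst T (sym e) tt)

  size≡0⇒∉ : (S : Subset m) → size S ≡ 0 → ∀ i → lookup S i ≢ true
  size≡0⇒∉ (false ∷ S) p fzero    ()
  size≡0⇒∉ (false ∷ S) p (fsuc i) e = size≡0⇒∉ S p i e

  size≡1⇒singleton : (S : Subset m) → size S ≡ 1 →
                     ∃ λ i → lookup S i ≡ true × (∀ k → lookup S k ≡ true → k ≡ i)
  size≡1⇒singleton (true ∷ S) p = fzero , refl , only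
    where
    only : ∀ k → lookup (true ∷ S) k ≡ true → k ≡ fzero
    only fzero    _ = refl
    only (fsuc k) e = ⊥-elim (size≡0⇒∉ S (suc-injective p) k e)
  size≡1⇒singleton (false ∷ S) p with size≡1⇒singleton S p
  ... | i , e , only = fsuc i , e , only′
    where
    only′ : ∀ k → lookup (false ∷ S) k ≡ true → k ≡ fsuc i
    only′ (fsuc k) e′ = cong fsuc (only k e′)

  size≡2⇒pair : (S : Subset m) → size S ≡ 2 →
                ∃₂ λ i j → i ≢ j × lookup S i ≡ true × lookup S j ≡ true ×
                           (∀ k → lookup S k ≡ true → k ≡ i ⊎ k ≡ j)
  size≡2⇒pair (true ∷ S) p with size≡1⇒singleton S (suc-injective p)
  ... | j , e , only = fzero , fsuc j , (λ ()) , refl , e , only′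
    where
    only′ : ∀ k → lookup (true ∷ S) k ≡ true → k ≡ fzero ⊎ k ≡ fsuc j
    only′ fzero    _  = inj₁ refl
    only′ (fsuc k) e′ = inj₂ (cong fsuc (only k e′))
  size≡2⇒pair (false ∷ S) p with size≡2⇒pair S p
  ... | i , j , i≢j , ei , ej , only = fsuc i , fsuc j , i≢j ∘ Fin.suc-injective , ei , ej , only′
    where
    only′ : ∀ k → lookup (false ∷ S) k ≡ true → k ≡ fsuc i ⊎ k ≡ fsuc j
    only′ (fsuc k) e′ with only k e′
    ... | inj₁ q = inj₁ (cong fsuc q)
    ... | inj₂ q = inj₂ (cong fsuc q)

  size>0⇒member : ∀ r (S : Subset m) → size S ≡ suc r → ∃ λ i → lookup S i ≡ true
  size>0⇒member r (true ∷ S)  p = fzero , refl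
  size>0⇒member r (false ∷ S) p with size>0⇒member r S p
  ... | i , e = fsuc i , e

  size>1⇒twoMembers : ∀ r (S : Subset m) → size S ≡ 2 + r →
                      ∃₂ λ i j → i ≢ j × lookup S i ≡ true × lookup S j ≡ true
  size>1⇒twoMembers r (true ∷ S) p with size>0⇒member r S (suc-injective p)
  ... | j , e = fzero , fsuc j , (λ ()) , refl , e
  size>1⇒twoMembers r (false ∷ S) p with size>1⇒twoMembers r S p
  ... | i , j , i≢j , ei , ej = fsuc i , fsuc j , i≢j ∘ Fin.suc-injective , ei , ej

  size>2⇒threeMembers : ∀ r (S : Subset m) → size S ≡ 3 + r →
    ∃₂ λ i j → ∃ λ k → i ≢ j × j ≢ k × i ≢ k × lookup S i ≡ true × lookup S j ≡ true × lookup S k ≡ true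
  size>2⇒threeMembers r (true ∷ S) p with size>1⇒twoMembers r S (suc-injective p)
  ... | j , k , j≢k , ej , ek = fzero , fsuc j , fsuc k , (λ ()) , j≢k ∘ Fin.suc-injective , (λ ()) , refl , ej , ek
  size>2⇒threeMembers r (false ∷ S) p with size>2⇒threeMembers r S p
  ... | i , j , k , i≢j , j≢k , i≢k , ei , ej , ek =
    fsuc i , fsuc j , fsuc k ,
    i≢j ∘ Fin.suc-injective , j≢k ∘ Fin.suc-injective , i≢k ∘ Fin.suc-injective , ei , ej , ek


  isIndependent-intro : ∀ X (S : Subset (n X)) →
    (∀ i j → lookup S i ≡ true → lookup S j ≡ true → adj X i j ≡ false) → isIndependent X S ≡ true
  isIndependent-intro X S h = all-true _ (allFin (n X)) (λ i → all-true _ (allFin (n X)) (nonadjacent i))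
    where
    nonadjacent : ∀ i j → not (lookup S i ∧ lookup S j ∧ adj X i j) ≡ true
    nonadjacent i j with lookup S i in ei | lookup S j in ej
    ... | false | _     = refl
    ... | true  | false = refl
    ... | true  | true  rewrite h i j ei ej = refl

  isIndependent-elim : ∀ X (S : Subset (n X)) → isIndependent X S ≡ true →
    ∀ i j → lookup S i ≡ true → lookup S j ≡ true → adj X i j ≡ false
  isIndependent-elim X S e i j ei ej
    with all-true⇒∈ _ (allFin (n X)) (all-true⇒∈ _ (allFin (n X)) e (∈-allFin i)) (∈-allFin j)
  ... | r rewrite ei | ej with adj X i j
  ... | false = refl

  size≡1⇒isIndependent : ∀ X (S : Subset (n X)) → size S ≡ 1 → isIndependent X S ≡ true
  size≡1⇒isIndependent X S p with size≡1⇒singleton S p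
  ... | i , _ , only = isIndependent-intro X S λ a b ea eb →
    subst₂ (λ a b → adj X a b ≡ false) (sym (only a ea)) (sym (only b eb)) (adj-irrefl X i)

  isIndependent-pair : ∀ X (S : Subset (n X)) i j → lookup S i ≡ true → lookup S j ≡ true →
    (∀ k → lookup S k ≡ true → k ≡ i ⊎ k ≡ j) → isIndependent X S ≡ not (adj X i j)
  isIndependent-pair X S i j ei ej only with adj X i j in eij
  ... | true with isIndependent X S in indep
  ...   | false = refl
  ...   | true  = ≡-trans (sym eij) (isIndependent-elim X S indep i j ei ej)
  isIndependent-pair X S i j ei ej only | false = isIndependent-intro X S nonadjacent
    where
    nonadjacent : ∀ a b → lookup S a ≡ true → lookup S b ≡ true → adj X a b ≡ false
    nonadjacent a b ea eb with only a ea | only b eb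
    ... | inj₁ refl | inj₁ refl = adj-irrefl X i
    ... | inj₁ refl | inj₂ refl = eij
    ... | inj₂ refl | inj₁ refl = ≡-trans (adj-sym X j i) eij
    ... | inj₂ refl | inj₂ refl = adj-irrefl X j

  adj-complement : ∀ G {i j : Fin (n G)} → i ≢ j → adj (complement G) i j ≡ not (adj G i j)
  adj-complement G {i} {j} i≢j with i Fin.≟ j
  ... | yes i≡j = ⊥-elim (i≢j i≡j)
  ... | no _ with adj G i j
  ...   | true  = refl
  ...   | false = refl

  size≡2⇒isIndependent-complement : ∀ G (S : Subset (n G)) → size S ≡ 2 →
    isIndependent (complement G) S ≡ not (isIndependent G S)
  size≡2⇒isIndependent-complement G S p with size≡2⇒pair S p
  ... | i , j , i≢j , ei , ej , only = begin
    isIndependent (complement G) S  ≡⟨ isIndependent-pair (complement G) S i j ei ej only ⟩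
    not (adj (complement G) i j)    ≡⟨ cong not (adj-complement G i≢j) ⟩
    not (not (adj G i j))           ≡⟨ cong not (isIndependent-pair G S i j ei ej only) ⟨
    not (isIndependent G S)         ∎
    where open ≡-Reasoning

  triangleFree⇒size>2⇒dependent-complement : ∀ G → TriangleFree G → ∀ r (S : Subset (n G)) →
    size S ≡ 3 + r → isIndependent (complement G) S ≡ false
  triangleFree⇒size>2⇒dependent-complement G triangleFree r S p with isIndependent (complement G) S in indep
  ... | false = refl
  ... | true with size>2⇒threeMembers r S p
  ...   | i , j , k , i≢j , j≢k , i≢k , ei , ej , ek =
    ⊥-elim (triangleFree i j k (adjacent i≢j ei ej) (adjacent j≢k ej ek) (adjacent i≢k ei ek))
    where
    adjacent : ∀ {a b} → a ≢ b → lookup S a ≡ true → lookup S b ≡ true → adj G a b ≡ true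
    adjacent {a} {b} a≢b ea eb with isIndependent-elim (complement G) S indep a b ea eb
    ... | nonadjacent rewrite adj-complement G a≢b with adj G a b
    ...   | true = refl

open IndependentSets

module ListSums {c ℓ : Level} (R : CommutativeRing c ℓ) where

  open CommutativeRing R
  open import Algebra.Properties.CommutativeSemigroup +-commutativeSemigroup
    using () renaming (interchange to +-interchange)

  private variable
    a : Level
    A B : Set a

  sum : List Carrier → Carrier
  sum = foldr _+_ 0#

  ∑ : List A → (A → Carrier) → Carrier
  ∑ xs f = sum (map f xs)

  syntax ∑ xs (λ x → e) = ∑[ x ← xs ] e

  ∑-cong : ∀ (xs : List A) {f g : A → Carrier} → (∀ x → f x ≈ g x) → ∑ xs f ≈ ∑ xs g
  ∑-cong []       h = refl
  ∑-cong (x ∷ xs) h = +-cong (h x) (∑-cong xs h)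

  sum-++ : ∀ xs ys → sum (xs ++ ys) ≈ sum xs + sum ys
  sum-++ []       ys = sym (+-identityˡ _)
  sum-++ (x ∷ xs) ys = trans (+-congˡ (sum-++ xs ys)) (sym (+-assoc _ _ _))

  ∑-++ : ∀ (xs ys : List A) (f : A → Carrier) → ∑ (xs ++ ys) f ≈ ∑ xs f + ∑ ys f
  ∑-++ xs ys f = trans (reflexive (≡.cong sum (map-++ f xs ys))) (sum-++ (map f xs) (map f ys))

  ∑-map : ∀ (g : A → B) (xs : List A) (f : B → Carrier) → ∑ (map g xs) f ≈ ∑[ x ← xs ] f (g x)
  ∑-map g []       f = refl
  ∑-map g (x ∷ xs) f = +-congˡ (∑-map g xs f)

  sum-concatMap : ∀ (g : A → List Carrier) (xs : List A) → sum (concatMap g xs) ≈ ∑[ x ← xs ] sum (g x)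
  sum-concatMap g []       = refl
  sum-concatMap g (x ∷ xs) = trans (sum-++ (g x) (concatMap g xs)) (+-congˡ (sum-concatMap g xs))

  ∑-concatMap : ∀ (g : A → List B) (xs : List A) (f : B → Carrier) → ∑ (concatMap g xs) f ≈ ∑[ x ← xs ] ∑ (g x) f
  ∑-concatMap g []       f = refl
  ∑-concatMap g (x ∷ xs) f = trans (∑-++ (g x) (concatMap g xs) f) (+-congˡ (∑-concatMap g xs f))

  ∑-0 : ∀ (xs : List A) → ∑[ x ← xs ] 0# ≈ 0#
  ∑-0 []       = refl
  ∑-0 (x ∷ xs) = trans (+-identityˡ _) (∑-0 xs)

  ∑-All-0 : ∀ {xs : List A} {f : A → Carrier} → All (λ x → f x ≈ 0#) xs → ∑ xs f ≈ 0#
  ∑-All-0 []         = refl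
  ∑-All-0 (fx≈0 ∷ p) = trans (+-cong fx≈0 (∑-All-0 p)) (+-identityˡ 0#)

  ∑-distrib-+ : ∀ (xs : List A) (f g : A → Carrier) → ∑[ x ← xs ] (f x + g x) ≈ ∑ xs f + ∑ xs g
  ∑-distrib-+ []       f g = sym (+-identityˡ _)
  ∑-distrib-+ (x ∷ xs) f g = trans (+-congˡ (∑-distrib-+ xs f g)) (+-interchange _ _ _ _)

  *-∑ : ∀ k (xs : List A) (f : A → Carrier) → k * ∑ xs f ≈ ∑[ x ← xs ] (k * f x)
  *-∑ k []       f = zeroʳ k
  *-∑ k (x ∷ xs) f = trans (distribˡ k _ _) (+-congˡ (*-∑ k xs f))

  ∑-comm : ∀ (xs : List A) (ys : List B) (h : A → B → Carrier) →
           ∑[ x ← xs ] ∑[ y ← ys ] h x y ≈ ∑[ y ← ys ] ∑[ x ← xs ] h x y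
  ∑-comm []       ys h = sym (∑-0 ys)
  ∑-comm (x ∷ xs) ys h = trans (+-congˡ (∑-comm xs ys h)) (sym (∑-distrib-+ ys (h x) _))

  choices : List (List A) → List (List A)
  choices []       = [] ∷ []
  choices (L ∷ Ls) = concatMap (λ x → map (x ∷_) (choices Ls)) L

  ∑× : List (List A) → (List A → Carrier) → Carrier
  ∑× []       F = F []
  ∑× (L ∷ Ls) F = ∑[ x ← L ] ∑× Ls (λ as → F (x ∷ as))

  syntax ∑× Ls (λ as → e) = ∑×[ as ← Ls ] e

  ∑-choices : ∀ (Ls : List (List A)) F → ∑ (choices Ls) F ≈ ∑× Ls F
  ∑-choices []       F = +-identityʳ _
  ∑-choices (L ∷ Ls) F = trans (∑-concatMap _ L F)
    (∑-cong L (λ x → trans (∑-map (x ∷_) (choices Ls) F) (∑-choices Ls _)))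

  ∑×-cong : ∀ (Ls : List (List A)) {F G : List A → Carrier} → (∀ as → F as ≈ G as) → ∑× Ls F ≈ ∑× Ls G
  ∑×-cong []       h = h []
  ∑×-cong (L ∷ Ls) h = ∑-cong L (λ x → ∑×-cong Ls (λ as → h (x ∷ as)))

  ∑×-0 : ∀ (Ls : List (List A)) → ∑×[ as ← Ls ] 0# ≈ 0#
  ∑×-0 []       = refl
  ∑×-0 (L ∷ Ls) = trans (∑-cong L (λ _ → ∑×-0 Ls)) (∑-0 L)

  *-∑× : ∀ k (Ls : List (List A)) F → k * ∑× Ls F ≈ ∑×[ as ← Ls ] (k * F as)
  *-∑× k []       F = refl
  *-∑× k (L ∷ Ls) F = trans (*-∑ k L _) (∑-cong L (λ x → *-∑× k Ls _))

  ∑-∑× : ∀ (L : List A) (Ms : List (List B)) (G : A → List B → Carrier) →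
         ∑[ x ← L ] ∑× Ms (G x) ≈ ∑×[ bs ← Ms ] ∑[ x ← L ] G x bs
  ∑-∑× L []       G = refl
  ∑-∑× L (M ∷ Ms) G = trans (∑-comm L M _) (∑-cong M (λ y → ∑-∑× L Ms (λ x bs → G x (y ∷ bs))))

  ∑×-comm : ∀ (Ls : List (List A)) (Ms : List (List B)) (H : List A → List B → Carrier) →
            ∑×[ as ← Ls ] ∑×[ bs ← Ms ] H as bs ≈ ∑×[ bs ← Ms ] ∑×[ as ← Ls ] H as bs
  ∑×-comm []       Ms H = refl
  ∑×-comm (L ∷ Ls) Ms H = trans (∑-cong L (λ x → ∑×-comm Ls Ms (λ as → H (x ∷ as))))
                                (∑-∑× L Ms (λ x bs → ∑×[ as ← Ls ] H (x ∷ as) bs))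

  ∑×-++ : ∀ (Ls Ms : List (List A)) F → ∑× (Ls ++ Ms) F ≈ ∑×[ as ← Ls ] ∑×[ bs ← Ms ] F (as ++ bs)
  ∑×-++ []       Ms F = refl
  ∑×-++ (L ∷ Ls) Ms F = ∑-cong L (λ x → ∑×-++ Ls Ms (λ as → F (x ∷ as)))

  ∑×-↭ : ∀ {Ls Ms : List (List A)} (F : List A → Carrier) → (∀ {as bs} → as ↭ bs → F as ≈ F bs) →
         Ls ↭ Ms → ∑× Ls F ≈ ∑× Ms F
  ∑×-↭ F F-↭ ↭.refl          = refl
  ∑×-↭ F F-↭ (↭.prep L p)    = ∑-cong L (λ x → ∑×-↭ (λ as → F (x ∷ as)) (F-↭ ∘ ↭.prep x) p)
  ∑×-↭ {Ls = L ∷ M ∷ Ls} {Ms = .M ∷ .L ∷ Ms} F F-↭ (↭.swap .L .M p) = begin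
    ∑[ x ← L ] ∑[ y ← M ] ∑×[ as ← Ls ] F (x ∷ y ∷ as)
      ≈⟨ ∑-cong L (λ x → ∑-cong M (λ y → ∑×-↭ _ (F-↭ ∘ ↭.prep x ∘ ↭.prep y) p)) ⟩
    ∑[ x ← L ] ∑[ y ← M ] ∑×[ as ← Ms ] F (x ∷ y ∷ as)
      ≈⟨ ∑-comm L M _ ⟩
    ∑[ y ← M ] ∑[ x ← L ] ∑×[ as ← Ms ] F (x ∷ y ∷ as)
      ≈⟨ ∑-cong M (λ y → ∑-cong L (λ x → ∑×-cong Ms (λ as → F-↭ (↭.swap x y ↭.refl)))) ⟩
    ∑[ y ← M ] ∑[ x ← L ] ∑×[ as ← Ms ] F (y ∷ x ∷ as) ∎
    where open import Relation.Binary.Reasoning.Setoid setoid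
  ∑×-↭ F F-↭ (↭.trans p q)   = trans (∑×-↭ F F-↭ p) (∑×-↭ F F-↭ q)

  χ : Bool → Carrier
  χ true  = 1#
  χ false = 0#

  ∑-boolFilter : ∀ {A : Set} (p : A → Bool) xs (f : A → Carrier) →
                 ∑ (boolFilter p xs) f ≈ ∑[ x ← xs ] (χ (p x) * f x)
  ∑-boolFilter p []       f = refl
  ∑-boolFilter p (x ∷ xs) f with p x
  ... | true  = +-cong (sym (*-identityˡ _)) (∑-boolFilter p xs f)
  ... | false = trans (∑-boolFilter p xs f) (sym (trans (+-congʳ (zeroˡ _)) (+-identityˡ _)))

  length-boolFilter : ∀ {A : Set} (p : A → Bool) xs →
                      ringFromℕ R (length (boolFilter p xs)) ≈ ∑[ x ← xs ] χ (p x)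
  length-boolFilter p []       = refl
  length-boolFilter p (x ∷ xs) with p x
  ... | true  = +-congˡ (length-boolFilter p xs)
  ... | false = trans (length-boolFilter p xs) (sym (+-identityˡ _))

module SubsetSums {c ℓ : Level} (R : CommutativeRing c ℓ) where

  open CommutativeRing R
  open ListSums R
  open import Relation.Binary.Reasoning.Setoid setoid
  open import Algebra.Solver.Ring.NaturalCoefficients.Default commutativeSemiring

  ∑-allSubsets-suc : ∀ {m} (F : Subset (suc m) → Carrier) →
    ∑ (allSubsets (suc m)) F ≈ ∑[ S ← allSubsets m ] F (true ∷ S) + ∑[ S ← allSubsets m ] F (false ∷ S)
  ∑-allSubsets-suc {m} F = trans (∑-concatMap _ (allSubsets m) F)
    (trans (∑-cong (allSubsets m) (λ S → +-congˡ (+-identityʳ _))) (∑-distrib-+ (allSubsets m) _ _))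

  ∑-ofSize-0 : ∀ m (g : Subset m → Carrier) → ∑[ S ← allSubsets m ] (χ (ofSize 0 S) * g S) ≈ g ⊥
  ∑-ofSize-0 zero    g = trans (+-identityʳ _) (*-identityˡ _)
  ∑-ofSize-0 (suc m) g = begin
    ∑[ S ← allSubsets (suc m) ] (χ (ofSize 0 S) * g S)
      ≈⟨ ∑-allSubsets-suc (λ S → χ (ofSize 0 S) * g S) ⟩
    ∑[ S ← allSubsets m ] (0# * g (true ∷ S)) + ∑[ S ← allSubsets m ] (χ (ofSize 0 S) * g (false ∷ S))
      ≈⟨ +-cong (trans (∑-cong (allSubsets m) (λ S → zeroˡ _)) (∑-0 (allSubsets m)))
                (∑-ofSize-0 m (λ S → g (false ∷ S))) ⟩
    0# + g ⊥
      ≈⟨ +-identityˡ _ ⟩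
    g ⊥ ∎

  ∑-singleton-pairs : ∀ m (h : Subset m → Carrier) →
    ∑[ S ← allSubsets m ] (χ (ofSize 1 S) * ∑[ T ← allSubsets m ] (χ (ofSize 1 T) * h (S ∪ T)))
    ≈ ∑[ S ← allSubsets m ] (χ (ofSize 1 S) * h S) +
      (∑[ S ← allSubsets m ] (χ (ofSize 2 S) * h S) + ∑[ S ← allSubsets m ] (χ (ofSize 2 S) * h S))
  ∑-singleton-pairs zero h = solve 1 (λ x → ((con 0 :* ((con 0 :* x) :+ con 0)) :+ con 0) :=
    (((con 0 :* x) :+ con 0) :+ (((con 0 :* x) :+ con 0) :+ ((con 0 :* x) :+ con 0)))) refl (h [])
  ∑-singleton-pairs (suc m) h = begin
    ∑[ S ← allSubsets (suc m) ] (χ (ofSize 1 S) * pairedWith S)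
      ≈⟨ ∑-allSubsets-suc (λ S → χ (ofSize 1 S) * pairedWith S) ⟩
    ∑[ S ← subsets ] (χ (ofSize 0 S) * pairedWith (true ∷ S)) +
    ∑[ S ← subsets ] (χ (ofSize 1 S) * pairedWith (false ∷ S))
      ≈⟨ +-cong (trans (∑-ofSize-0 m (λ S → pairedWith (true ∷ S))) pairedWith-first)
                (trans (∑-cong subsets (λ S → trans (*-congˡ (pairedWith-rest S)) (distribˡ _ _ _)))
                       (∑-distrib-+ subsets _ _)) ⟩
    (h (true ∷ ⊥) + X) +
    (X + ∑[ S ← subsets ] (χ (ofSize 1 S) * ∑[ T ← subsets ] (χ (ofSize 1 T) * h (false ∷ (S ∪ T)))))
      ≈⟨ +-congˡ (+-congˡ (∑-singleton-pairs m (λ S → h (false ∷ S)))) ⟩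
    (h (true ∷ ⊥) + X) + (X + (a′ + (b′ + b′)))
      ≈⟨ solve 4 (λ h₀ X a′ b′ → ((h₀ :+ X) :+ (X :+ (a′ :+ (b′ :+ b′)))) := ((h₀ :+ a′) :+ ((X :+ b′) :+ (X :+ b′))))
               refl (h (true ∷ ⊥)) X a′ b′ ⟩
    (h (true ∷ ⊥) + a′) + ((X + b′) + (X + b′))
      ≈⟨ sym (+-cong (trans (∑-allSubsets-suc (λ S → χ (ofSize 1 S) * h S))
                            (+-congʳ (∑-ofSize-0 m (λ S → h (true ∷ S)))))
                     (+-cong (∑-allSubsets-suc (λ S → χ (ofSize 2 S) * h S))
                             (∑-allSubsets-suc (λ S → χ (ofSize 2 S) * h S)))) ⟩
    ∑[ S ← allSubsets (suc m) ] (χ (ofSize 1 S) * h S) +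
      (∑[ S ← allSubsets (suc m) ] (χ (ofSize 2 S) * h S) + ∑[ S ← allSubsets (suc m) ] (χ (ofSize 2 S) * h S)) ∎
    where
    subsets = allSubsets m
    pairedWith : Subset (suc m) → Carrier
    pairedWith U = ∑[ T ← allSubsets (suc m) ] (χ (ofSize 1 T) * h (U ∪ T))
    X a′ b′ : Carrier
    X  = ∑[ T ← subsets ] (χ (ofSize 1 T) * h (true ∷ T))
    a′ = ∑[ S ← subsets ] (χ (ofSize 1 S) * h (false ∷ S))
    b′ = ∑[ S ← subsets ] (χ (ofSize 2 S) * h (false ∷ S))
    pairedWith-first : pairedWith (true ∷ ⊥) ≈ h (true ∷ ⊥) + X
    pairedWith-first = trans (∑-allSubsets-suc (λ T → χ (ofSize 1 T) * h ((true ∷ ⊥) ∪ T)))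
      (+-cong (trans (∑-ofSize-0 m (λ T → h (true ∷ (⊥ ∪ T))))
                     (reflexive (≡.cong (λ W → h (true ∷ W)) (∪-identityˡ ⊥))))
              (∑-cong subsets (λ T → *-congˡ (reflexive (≡.cong (λ W → h (true ∷ W)) (∪-identityˡ T))))))
    pairedWith-rest : ∀ S →
      pairedWith (false ∷ S) ≈ h (true ∷ S) + ∑[ T ← subsets ] (χ (ofSize 1 T) * h (false ∷ (S ∪ T)))
    pairedWith-rest S = trans (∑-allSubsets-suc (λ T → χ (ofSize 1 T) * h ((false ∷ S) ∪ T)))
      (+-congʳ (trans (∑-ofSize-0 m (λ T → h (true ∷ (S ∪ T))))
                      (reflexive (≡.cong (λ W → h (true ∷ W)) (∪-identityʳ S)))))

module CoverSums {c ℓ : Level} (R : CommutativeRing c ℓ) where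

  open CommutativeRing R
  open ListSums R

  coverSum : ∀ {m} → (ℕ → List (Subset m)) → (Subset m → Carrier) → List ℕ → Carrier
  coverSum I Ψ ks = ∑×[ Ss ← map I ks ] Ψ (⋃ Ss)

  coverSum-↭ : ∀ {m} (I : ℕ → List (Subset m)) Ψ {ks ls} → ks ↭ ls → coverSum I Ψ ks ≈ coverSum I Ψ ls
  coverSum-↭ I Ψ p = ∑×-↭ _ (λ q → reflexive (≡.cong Ψ (⋃-↭ q))) (map⁺ I p)

  coverSum-++ : ∀ {m} (I : ℕ → List (Subset m)) Ψ ks ls →
    coverSum I Ψ (ks ++ ls) ≈ coverSum I (λ W → coverSum I (λ W′ → Ψ (W ∪ W′)) ls) ks
  coverSum-++ I Ψ ks ls = trans (reflexive (≡.cong (λ L → ∑×[ Ss ← L ] Ψ (⋃ Ss)) (map-++ I ks ls)))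
    (trans (∑×-++ (map I ks) (map I ls) _)
      (∑×-cong (map I ks) (λ Ts → ∑×-cong (map I ls) (λ Ss → reflexive (≡.cong Ψ (⋃-++ Ts Ss))))))

  tuples≡choices : ∀ G ks → tuples G ks ≡.≡ choices (map (indepOfSize G) ks)
  tuples≡choices G []       = ≡.refl
  tuples≡choices G (k ∷ ks) = ≡.cong (λ L → concatMap (λ S → map (S ∷_) L) (indepOfSize G k)) (tuples≡choices G ks)

  setColoringCount≈coverSum : ∀ G λ′ →
    ringFromℕ R (setColoringCount G λ′) ≈ coverSum (indepOfSize G) (χ ∘ isFull) (parts λ′)
  setColoringCount≈coverSum G λ′ = begin
    ringFromℕ R (length (boolFilter (covers G) (tuples G (parts λ′))))
      ≈⟨ length-boolFilter (covers G) (tuples G (parts λ′)) ⟩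
    ∑[ Ss ← tuples G (parts λ′) ] χ (covers G Ss)
      ≡⟨ ≡.cong (λ L → ∑[ Ss ← L ] χ (covers G Ss)) (tuples≡choices G (parts λ′)) ⟩
    ∑[ Ss ← choices (map (indepOfSize G) (parts λ′)) ] χ (covers G Ss)
      ≈⟨ ∑-choices (map (indepOfSize G) (parts λ′)) _ ⟩
    ∑×[ Ss ← map (indepOfSize G) (parts λ′) ] χ (covers G Ss)
      ≈⟨ ∑×-cong (map (indepOfSize G) (parts λ′)) (λ Ss → reflexive (≡.cong χ (covers≡isFull-⋃ G Ss))) ⟩
    coverSum (indepOfSize G) (χ ∘ isFull) (parts λ′) ∎
    where open import Relation.Binary.Reasoning.Setoid setoid

  ∑-indepOfSize : ∀ X k (f : Subset (n X) → Carrier) →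
    ∑ (indepOfSize X k) f ≈ ∑[ S ← allSubsets (n X) ] (χ (isIndependent X S ∧ ofSize k S) * f S)
  ∑-indepOfSize X k f = trans (∑-boolFilter _ (allSubsets (n X)) f) (∑-cong (allSubsets (n X)) (λ S →
    *-congʳ (reflexive (≡.cong (λ b → χ (isIndependent X S ∧ b)) (isYes≗does (size S ≟ k))))))

  ∑-indepOfSize-1 : ∀ X (f : Subset (n X) → Carrier) →
    ∑ (indepOfSize X 1) f ≈ ∑[ S ← allSubsets (n X) ] (χ (ofSize 1 S) * f S)
  ∑-indepOfSize-1 X f = trans (∑-indepOfSize X 1 f) (∑-cong (allSubsets (n X)) (λ S →
    *-congʳ (reflexive (≡.cong χ (singletons-independent S)))))
    where
    singletons-independent : ∀ S → isIndependent X S ∧ ofSize 1 S ≡ ofSize 1 S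
    singletons-independent S with ofSize 1 S in e
    ... | true  rewrite size≡1⇒isIndependent X S (ofSize⇒size≡ 1 S e) = ≡.refl
    ... | false = ∧-zeroʳ _

  χ-pair : ∀ G (S : Subset (n G)) →
    χ (isIndependent G S ∧ ofSize 2 S) + χ (isIndependent (complement G) S ∧ ofSize 2 S) ≈ χ (ofSize 2 S)
  χ-pair G S with ofSize 2 S in e
  ... | false rewrite ∧-zeroʳ (isIndependent G S) | ∧-zeroʳ (isIndependent (complement G) S) = +-identityʳ _
  ... | true  rewrite size≡2⇒isIndependent-complement G S (ofSize⇒size≡ 2 S e) with isIndependent G S
  ...   | true  = +-identityʳ _
  ...   | false = +-identityˡ _

-- rule k lists the weighted replacements of a part k + 1: an option (cs , a)
-- replaces it by the parts map suc cs, with weight a.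
module PartSubstitution {c ℓ : Level} (K : CharZeroField c ℓ)
  (rule : ℕ → List (List ℕ × CharZeroField.Carrier K)) where

  open CharZeroField K
  open SymFun K
  open ListSums commRing
  open CoverSums commRing
  open import Relation.Binary.Reasoning.Setoid setoid
  open import Algebra.Properties.CommutativeSemigroup *-commutativeSemigroup using (x∙yz≈y∙xz)

  Option : Set c
  Option = List ℕ × Carrier

  -- A zero entry is not a part (toPartition drops it) and is replaced by nothing.
  options : ℕ → List Option
  options zero    = ([] , 1#) ∷ []
  options (suc k) = rule k

  newParts : Option → List ℕ
  newParts o = map suc (proj₁ o)

  coeff : Option → Carrier
  coeff = proj₂

  partsOf : List Option → List ℕ
  partsOf []       = []
  partsOf (o ∷ os) = newParts o ++ partsOf os

  weight : List Option → Carrier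
  weight []       = 1#
  weight (o ∷ os) = coeff o * weight os

  Φ : ContLinMap
  Φ = record
    { row = λ λ′ → map (λ os → toPartition (partsOf os) , weight os) (choices (map options (parts λ′))) }

  expand : List ℕ → (List ℕ → Carrier) → Carrier
  expand ks F = ∑×[ os ← map options ks ] (weight os * F (partsOf os))

  ∑-row : ∀ λ′ (h : Partition × Carrier → Carrier) →
    ∑ (row Φ λ′) h ≈ ∑×[ os ← map options (parts λ′) ] h (toPartition (partsOf os) , weight os)
  ∑-row λ′ h = trans (∑-map _ (choices (map options (parts λ′))) h) (∑-choices (map options (parts λ′)) _)

  apply-expand : ∀ f λ′ → apply Φ f λ′ ≈ expand (parts λ′) (f ∘ toPartition)
  apply-expand f λ′ = ∑-row λ′ (λ p → proj₂ p * f (proj₁ p))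

  expand-cong : ∀ ks {F G : List ℕ → Carrier} → (∀ s → F s ≈ G s) → expand ks F ≈ expand ks G
  expand-cong ks h = ∑×-cong (map options ks) (λ os → *-congˡ (h (partsOf os)))

  expand-[] : ∀ F → expand [] F ≈ F []
  expand-[] F = *-identityˡ _

  expand-∷ : ∀ k ks F →
    expand (k ∷ ks) F ≈ ∑[ o ← options k ] (coeff o * expand ks (λ s → F (newParts o ++ s)))
  expand-∷ k ks F = ∑-cong (options k) (λ o →
    trans (∑×-cong (map options ks) (λ os → *-assoc _ _ _)) (sym (*-∑× (coeff o) (map options ks) _)))

  expand-++ : ∀ ks ls F → expand (ks ++ ls) F ≈ expand ks (λ s → expand ls (λ t → F (s ++ t)))
  expand-++ []       ls F = sym (expand-[] (λ s → expand ls (λ t → F (s ++ t))))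
  expand-++ (k ∷ ks) ls F = begin
    expand (k ∷ ks ++ ls) F
      ≈⟨ expand-∷ k (ks ++ ls) F ⟩
    ∑[ o ← options k ] (coeff o * expand (ks ++ ls) (λ s → F (newParts o ++ s)))
      ≈⟨ ∑-cong (options k) (λ o → *-congˡ (trans (expand-++ ks ls (λ u → F (newParts o ++ u)))
           (expand-cong ks (λ s → expand-cong ls (λ t → reflexive (≡.cong F (≡.sym (++-assoc (newParts o) s t)))))))) ⟩
    ∑[ o ← options k ] (coeff o * expand ks (λ s → expand ls (λ t → F ((newParts o ++ s) ++ t))))
      ≈⟨ expand-∷ k ks (λ s → expand ls (λ t → F (s ++ t))) ⟨
    expand (k ∷ ks) (λ s → expand ls (λ t → F (s ++ t))) ∎

  *-expand : ∀ ks k F → k * expand ks F ≈ expand ks (λ s → k * F s)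
  *-expand ks k F = trans (*-∑× k (map options ks) _) (∑×-cong (map options ks) (λ os → x∙yz≈y∙xz k _ _))

  expand-∑ : ∀ {a} {A : Set a} ks (L : List A) (G : A → List ℕ → Carrier) →
    expand ks (λ s → ∑[ x ← L ] G x s) ≈ ∑[ x ← L ] expand ks (G x)
  expand-∑ ks L G = trans (∑×-cong (map options ks) (λ os → *-∑ (weight os) L _)) (sym (∑-∑× L (map options ks) _))

  expand-∑× : ∀ {a} {A : Set a} ks (Ls : List (List A)) (G : List ℕ → List A → Carrier) →
    expand ks (λ s → ∑× Ls (G s)) ≈ ∑×[ as ← Ls ] expand ks (λ s → G s as)
  expand-∑× ks Ls G = trans (∑×-cong (map options ks) (λ os → *-∑× (weight os) Ls _)) (∑×-comm (map options ks) Ls _)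

  PermInvariant : (List ℕ → Carrier) → Set ℓ
  PermInvariant F = ∀ {s t} → s ↭ t → F s ≈ F t

  toPartition-permInvariant : ∀ (f : Sym) → PermInvariant (f ∘ toPartition)
  toPartition-permInvariant f {s} {t} p = reflexive (≡.cong f (toPartition-cong s t (nonzeroCodes-↭ p)))

  weight-↭ : ∀ {os os′} → os ↭ os′ → weight os ≈ weight os′
  weight-↭ ↭.refl           = refl
  weight-↭ (↭.prep o p)     = *-congˡ (weight-↭ p)
  weight-↭ (↭.swap o o′ p)  = trans (*-congˡ (*-congˡ (weight-↭ p))) (x∙yz≈y∙xz (coeff o) (coeff o′) _)
  weight-↭ (↭.trans p q)    = trans (weight-↭ p) (weight-↭ q)

  partsOf-↭ : ∀ {os os′} → os ↭ os′ → partsOf os ↭ partsOf os′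
  partsOf-↭ ↭.refl          = ↭.refl
  partsOf-↭ (↭.prep o p)    = ++⁺ˡ (newParts o) (partsOf-↭ p)
  partsOf-↭ (↭.swap o o′ p) =
    ↭.trans (++⁺ˡ (newParts o) (++⁺ˡ (newParts o′) (partsOf-↭ p))) (shifts (newParts o) (newParts o′))
  partsOf-↭ (↭.trans p q)   = ↭.trans (partsOf-↭ p) (partsOf-↭ q)

  expand-↭ : ∀ {ks ls} F → PermInvariant F → ks ↭ ls → expand ks F ≈ expand ls F
  expand-↭ F F-↭ p = ∑×-↭ _ (λ q → *-cong (weight-↭ q) (F-↭ (partsOf-↭ q))) (map⁺ options p)

  expand-nonzero : ∀ ks F → expand ks F ≈ expand (map suc (nonzeroCodes ks)) F
  expand-nonzero []           F = refl
  expand-nonzero (zero  ∷ ks) F =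
    trans (expand-∷ 0 ks F) (trans (+-identityʳ _) (trans (*-identityˡ _) (expand-nonzero ks F)))
  expand-nonzero (suc k ∷ ks) F = trans (expand-∷ (suc k) ks F)
    (trans (∑-cong (rule k) (λ o → *-congˡ (expand-nonzero ks (λ s → F (newParts o ++ s)))))
           (sym (expand-∷ (suc k) (map suc (nonzeroCodes ks)) F)))

  apply-expand-toPartition : ∀ f s → apply Φ f (toPartition s) ≈ expand s (f ∘ toPartition)
  apply-expand-toPartition f s = begin
    apply Φ f (toPartition s)
      ≈⟨ apply-expand f (toPartition s) ⟩
    expand (parts (toPartition s)) (f ∘ toPartition)
      ≈⟨ expand-↭ (f ∘ toPartition) (toPartition-permInvariant f) (parts-toPartition s) ⟩
    expand (map suc (nonzeroCodes s)) (f ∘ toPartition)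
      ≈⟨ expand-nonzero s (f ∘ toPartition) ⟨
    expand s (f ∘ toPartition) ∎

  -- Coalgebra structure and unit

  expand-0 : ∀ ks → expand ks (λ _ → 0#) ≈ 0#
  expand-0 ks = trans (∑×-cong (map options ks) (λ os → zeroʳ (weight os))) (∑×-0 (map options ks))

  preserves-Δ : ∀ f → Δ (apply Φ f) ≐² apply² Φ (Δ f)
  preserves-Δ f μ ν = begin
    apply Φ f (toPartition (parts μ ++ parts ν))
      ≈⟨ apply-expand-toPartition f (parts μ ++ parts ν) ⟩
    expand (parts μ ++ parts ν) (f ∘ toPartition)
      ≈⟨ expand-++ (parts μ) (parts ν) (f ∘ toPartition) ⟩
    expand (parts μ) (λ s → expand (parts ν) (λ t → f (toPartition (s ++ t))))
      ≈⟨ ∑×-cong (map options (parts μ)) (λ os → trans (*-∑× (weight os) (map options (parts ν)) _)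
           (∑×-cong (map options (parts ν)) (λ os′ → trans (sym (*-assoc _ _ _))
             (*-congˡ (reflexive (≡.cong f (≡.sym (toPartition-++ (partsOf os) (partsOf os′))))))))) ⟩
    ∑×[ os ← map options (parts μ) ] ∑×[ os′ ← map options (parts ν) ]
      ((weight os * weight os′) * f (toPartition (partsOf os) ⊔ₚ toPartition (partsOf os′)))
      ≈⟨ trans (∑-row μ _) (∑×-cong (map options (parts μ)) (λ os → ∑-row ν _)) ⟨
    ∑[ p ← row Φ μ ] ∑[ q ← row Φ ν ] ((proj₂ p * proj₂ q) * f (proj₁ p ⊔ₚ proj₁ q))
      ≈⟨ sum-concatMap _ (row Φ μ) ⟨
    apply² Φ (Δ f) μ ν ∎

  preserves-ε : ∀ f → ε (apply Φ f) ≈ ε f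
  preserves-ε f = trans (apply-expand-toPartition f []) (expand-[] (f ∘ toPartition))

  one-nonempty : ∀ λ′ {y r} → codes λ′ ↭ y ∷ r → one λ′ ≈ 0#
  one-nonempty (mkPartition []      _) p with ↭-length p
  ... | ()
  one-nonempty (mkPartition (_ ∷ _) _) p = refl

  preserves-1 : (∀ k → All (λ o → proj₁ o ≢ []) (rule k)) → apply Φ one ≐ one
  preserves-1 nonempty λ′ = trans (apply-expand one λ′) (expand-one λ′)
    where
    vanishes : ∀ ks o → proj₁ o ≢ [] → coeff o * expand ks (λ s → one (toPartition (newParts o ++ s))) ≈ 0#
    vanishes ks (y ∷ r , _) _ = trans (*-congˡ (trans
      (expand-cong ks (λ s → one-nonempty (toPartition (suc y ∷ map suc r ++ s))
                                          (codes-toPartition (suc y ∷ map suc r ++ s))))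
      (expand-0 ks))) (zeroʳ _)
    vanishes ks ([] , _) ≢[] = ⊥-elim (≢[] ≡.refl)
    expand-one : ∀ λ′ → expand (parts λ′) (one ∘ toPartition) ≈ one λ′
    expand-one (mkPartition []       _) = expand-[] (one ∘ toPartition)
    expand-one (mkPartition (k ∷ ks) _) =
      trans (expand-∷ (suc k) (map suc ks) (one ∘ toPartition))
            (∑-All-0 (All.map (vanishes (map suc ks) _) (nonempty k)))

  expand-* : ∀ ks ls F G → expand ks F * expand ls G ≈ expand ks (λ s → expand ls (λ t → F s * G t))
  expand-* ks ls F G = begin
    expand ks F * expand ls G                        ≈⟨ *-comm _ _ ⟩
    expand ls G * expand ks F                        ≈⟨ *-expand ks (expand ls G) F ⟩
    expand ks (λ s → expand ls G * F s)              ≈⟨ expand-cong ks (λ s → trans (*-comm _ _) (*-expand ls (F s) G)) ⟩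
    expand ks (λ s → expand ls (λ t → F s * G t))    ∎

  -- Products

  DependsOnPartitions : (List ℕ → List ℕ → Carrier) → Set ℓ
  DependsOnPartitions H = ∀ α α′ β β′ →
    nonzeroCodes α ↭ nonzeroCodes α′ → nonzeroCodes β ↭ nonzeroCodes β′ → H α β ≈ H α′ β′

  shift : (List ℕ → List ℕ → Carrier) → List ℕ → List ℕ → List ℕ → List ℕ → Carrier
  shift H γ δ α β = H (γ ++ α) (δ ++ β)

  shift-dependsOnPartitions : ∀ H γ δ → DependsOnPartitions H → DependsOnPartitions (shift H γ δ)
  shift-dependsOnPartitions H γ δ H-inv α α′ β β′ p q =
    H-inv (γ ++ α) (γ ++ α′) (δ ++ β) (δ ++ β′)
          (nonzeroCodes-++⁺ {γ} {γ} {α} {α′} ↭.refl p) (nonzeroCodes-++⁺ {δ} {δ} {β} {β′} ↭.refl q)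

  splitPairs : ℕ → List (ℕ × ℕ)
  splitPairs x = map (λ a → a , x ∸ a) (range x)

  convolution : (List ℕ → List ℕ → Carrier) → List ℕ → Carrier
  convolution H xs = ∑×[ ps ← map splitPairs xs ] H (map proj₁ ps) (map proj₂ ps)

  ∑-boxes : ∀ xs H → ∑[ α ← boxes xs ] H α (zipWith _∸_ xs α) ≈ convolution H xs
  ∑-boxes []       H = +-identityʳ _
  ∑-boxes (x ∷ xs) H = begin
    ∑[ α ← boxes (x ∷ xs) ] H α (zipWith _∸_ (x ∷ xs) α)
      ≈⟨ ∑-concatMap _ (range x) _ ⟩
    ∑[ a ← range x ] ∑[ α ← map (a ∷_) (boxes xs) ] H α (zipWith _∸_ (x ∷ xs) α)
      ≈⟨ ∑-cong (range x) (λ a → trans (∑-map (a ∷_) (boxes xs) _) (∑-boxes xs (shift H (a ∷ []) (x ∸ a ∷ [])))) ⟩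
    ∑[ a ← range x ] convolution (shift H (a ∷ []) (x ∸ a ∷ [])) xs
      ≈⟨ ∑-map (λ a → a , x ∸ a) (range x) _ ⟨
    convolution H (x ∷ xs) ∎

  convolution-cong : ∀ xs {H H′} → (∀ α β → H α β ≈ H′ α β) → convolution H xs ≈ convolution H′ xs
  convolution-cong xs h = ∑×-cong (map splitPairs xs) (λ ps → h _ _)

  convolution-↭ : ∀ H → DependsOnPartitions H → ∀ {xs ys} → xs ↭ ys → convolution H xs ≈ convolution H ys
  convolution-↭ H H-inv p =
    ∑×-↭ _ (λ q → H-inv _ _ _ _ (nonzeroCodes-↭ (map⁺ proj₁ q)) (nonzeroCodes-↭ (map⁺ proj₂ q))) (map⁺ splitPairs p)

  convolution-nonzero : ∀ xs H → DependsOnPartitions H → convolution H xs ≈ convolution H (map suc (nonzeroCodes xs))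
  convolution-nonzero []           H H-inv = refl
  convolution-nonzero (zero  ∷ xs) H H-inv = trans (+-identityʳ _)
    (trans (convolution-cong xs (λ α β → H-inv (0 ∷ α) α (0 ∷ β) β ↭.refl ↭.refl)) (convolution-nonzero xs H H-inv))
  convolution-nonzero (suc x ∷ xs) H H-inv = ∑-cong (splitPairs (suc x)) (λ p →
    convolution-nonzero xs (shift H (proj₁ p ∷ []) (proj₂ p ∷ [])) (shift-dependsOnPartitions H _ _ H-inv))

  convolution-toPartition : ∀ s H → DependsOnPartitions H → convolution H (parts (toPartition s)) ≈ convolution H s
  convolution-toPartition s H H-inv =
    trans (convolution-↭ H H-inv (parts-toPartition s)) (sym (convolution-nonzero s H H-inv))

  convolution-++ : ∀ xs ys H →
    convolution H (xs ++ ys) ≈ ∑×[ ps ← map splitPairs xs ] convolution (shift H (map proj₁ ps) (map proj₂ ps)) ys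
  convolution-++ xs ys H = begin
    convolution H (xs ++ ys)
      ≡⟨ ≡.cong (λ L → ∑×[ ps ← L ] H (map proj₁ ps) (map proj₂ ps)) (map-++ splitPairs xs ys) ⟩
    ∑×[ ps ← map splitPairs xs ++ map splitPairs ys ] H (map proj₁ ps) (map proj₂ ps)
      ≈⟨ ∑×-++ (map splitPairs xs) (map splitPairs ys) _ ⟩
    ∑×[ ps ← map splitPairs xs ] ∑×[ qs ← map splitPairs ys ] H (map proj₁ (ps ++ qs)) (map proj₂ (ps ++ qs))
      ≈⟨ ∑×-cong (map splitPairs xs) (λ ps → ∑×-cong (map splitPairs ys) (λ qs →
           reflexive (≡.cong₂ H (map-++ proj₁ ps qs) (map-++ proj₂ ps qs)))) ⟩
    ∑×[ ps ← map splitPairs xs ] convolution (shift H (map proj₁ ps) (map proj₂ ps)) ys ∎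

  expandConvolution : List ℕ → (List ℕ → List ℕ → Carrier) → Carrier
  expandConvolution ks H = expand ks (convolution H)

  expandSplits : List ℕ → (List ℕ → List ℕ → Carrier) → Carrier
  expandSplits ks H = ∑[ p ← splits ks ] expand (proj₁ p) (λ s → expand (proj₂ p) (H s))

  expandSplits-cong : ∀ ks {H H′} → (∀ α β → H α β ≈ H′ α β) → expandSplits ks H ≈ expandSplits ks H′
  expandSplits-cong ks h = ∑-cong (splits ks) (λ p → expand-cong (proj₁ p) (λ s → expand-cong (proj₂ p) (h s)))

  expandConvolution-∷ : ∀ k ks H → expandConvolution (k ∷ ks) H ≈
    ∑[ o ← options k ] (coeff o * ∑×[ ps ← map splitPairs (newParts o) ]
                                     expandConvolution ks (shift H (map proj₁ ps) (map proj₂ ps)))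
  expandConvolution-∷ k ks H = trans (expand-∷ k ks (convolution H)) (∑-cong (options k) (λ o → *-congˡ
    (trans (expand-cong ks (λ s → convolution-++ (newParts o) s H))
           (expand-∑× ks (map splitPairs (newParts o))
                      (λ s ps → convolution (shift H (map proj₁ ps) (map proj₂ ps)) s)))))

  expandSplits-∷ : ∀ k ks H → expandSplits (k ∷ ks) H ≈
    ∑[ o ← options k ] (coeff o * expandSplits ks (shift H (newParts o) [])) +
    ∑[ o ← options k ] (coeff o * expandSplits ks (shift H [] (newParts o)))
  expandSplits-∷ k ks H = begin
    expandSplits (k ∷ ks) H
      ≈⟨ ∑-concatMap _ (splits ks) _ ⟩
    ∑[ p ← splits ks ] (E H (k ∷ proj₁ p) (proj₂ p) + (E H (proj₁ p) (k ∷ proj₂ p) + 0#))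
      ≈⟨ ∑-cong (splits ks) (λ p → +-cong (left p) (trans (+-identityʳ _) (right p))) ⟩
    ∑[ p ← splits ks ] (∑[ o ← options k ] (coeff o * E (shift H (newParts o) []) (proj₁ p) (proj₂ p)) +
                        ∑[ o ← options k ] (coeff o * E (shift H [] (newParts o)) (proj₁ p) (proj₂ p)))
      ≈⟨ ∑-distrib-+ (splits ks) _ _ ⟩
    _ ≈⟨ +-cong (pull (λ o → shift H (newParts o) [])) (pull (λ o → shift H [] (newParts o))) ⟩
    ∑[ o ← options k ] (coeff o * expandSplits ks (shift H (newParts o) [])) +
    ∑[ o ← options k ] (coeff o * expandSplits ks (shift H [] (newParts o))) ∎
    where
    E : (List ℕ → List ℕ → Carrier) → List ℕ → List ℕ → Carrier
    E H′ ls ms = expand ls (λ s → expand ms (H′ s))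
    left : ∀ p →
      E H (k ∷ proj₁ p) (proj₂ p) ≈ ∑[ o ← options k ] (coeff o * E (shift H (newParts o) []) (proj₁ p) (proj₂ p))
    left p = expand-∷ k (proj₁ p) (λ s → expand (proj₂ p) (H s))
    right : ∀ p →
      E H (proj₁ p) (k ∷ proj₂ p) ≈ ∑[ o ← options k ] (coeff o * E (shift H [] (newParts o)) (proj₁ p) (proj₂ p))
    right p = begin
      E H (proj₁ p) (k ∷ proj₂ p)
        ≈⟨ expand-cong (proj₁ p) (λ s → expand-∷ k (proj₂ p) (H s)) ⟩
      expand (proj₁ p) (λ s → ∑[ o ← options k ] (coeff o * expand (proj₂ p) (λ t → H s (newParts o ++ t))))
        ≈⟨ expand-∑ (proj₁ p) (options k) (λ o s → coeff o * expand (proj₂ p) (λ t → H s (newParts o ++ t))) ⟩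
      ∑[ o ← options k ] expand (proj₁ p) (λ s → coeff o * expand (proj₂ p) (λ t → H s (newParts o ++ t)))
        ≈⟨ ∑-cong (options k) (λ o →
             *-expand (proj₁ p) (coeff o) (λ s → expand (proj₂ p) (λ t → H s (newParts o ++ t)))) ⟨
      ∑[ o ← options k ] (coeff o * E (shift H [] (newParts o)) (proj₁ p) (proj₂ p)) ∎
    pull : ∀ (Hₒ : Option → List ℕ → List ℕ → Carrier) →
      ∑[ p ← splits ks ] ∑[ o ← options k ] (coeff o * E (Hₒ o) (proj₁ p) (proj₂ p)) ≈
      ∑[ o ← options k ] (coeff o * expandSplits ks (Hₒ o))
    pull Hₒ = trans (∑-comm (splits ks) (options k) _) (∑-cong (options k) (λ o → sym (*-∑ (coeff o) (splits ks) _)))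

  -- For Q α β = f (toPartition α) * g (toPartition β) this says
  -- Φ (f · g) ((k+1)) = Φ f ((k+1)) * ε g + ε f * Φ g ((k+1)); arbitrary Q are
  -- needed to run the induction over the parts.
  IsDerivation : ℕ → Set (c ⊔ ℓ)
  IsDerivation k = ∀ Q → DependsOnPartitions Q →
    ∑[ o ← rule k ] (coeff o * convolution Q (newParts o)) ≈
    ∑[ o ← rule k ] (coeff o * Q (newParts o) []) + ∑[ o ← rule k ] (coeff o * Q [] (newParts o))

  expandConvolution≈expandSplits : (∀ k → IsDerivation k) →
    ∀ cds H → DependsOnPartitions H → expandConvolution (map suc cds) H ≈ expandSplits (map suc cds) H
  expandConvolution≈expandSplits derivation [] H H-inv = begin
    expand [] (convolution H)                         ≈⟨ expand-[] (convolution H) ⟩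
    H [] []                                           ≈⟨ expand-[] (λ t → H [] t) ⟨
    expand [] (H [])                                  ≈⟨ expand-[] (λ s → expand [] (H s)) ⟨
    expand [] (λ s → expand [] (H s))                 ≈⟨ +-identityʳ _ ⟨
    expandSplits [] H                                 ∎
  expandConvolution≈expandSplits derivation (c ∷ cds) H H-inv = begin
    expandConvolution (suc c ∷ ks) H
      ≈⟨ expandConvolution-∷ (suc c) ks H ⟩
    ∑[ o ← rule c ] (coeff o * ∑×[ ps ← map splitPairs (newParts o) ]
                                 expandConvolution ks (shift H (map proj₁ ps) (map proj₂ ps)))
      ≈⟨ ∑-cong (rule c) (λ o → *-congˡ (∑×-cong (map splitPairs (newParts o)) (λ ps →
           expandConvolution≈expandSplits derivation cds _ (shift-dependsOnPartitions H _ _ H-inv)))) ⟩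
    ∑[ o ← rule c ] (coeff o * convolution Q (newParts o))
      ≈⟨ derivation c Q Q-inv ⟩
    ∑[ o ← rule c ] (coeff o * Q (newParts o) []) + ∑[ o ← rule c ] (coeff o * Q [] (newParts o))
      ≈⟨ expandSplits-∷ (suc c) ks H ⟨
    expandSplits (suc c ∷ ks) H ∎
    where
    ks = map suc cds
    Q : List ℕ → List ℕ → Carrier
    Q α β = expandSplits ks (shift H α β)
    Q-inv : DependsOnPartitions Q
    Q-inv α α′ β β′ p q = expandSplits-cong ks (λ s t →
      H-inv (α ++ s) (α′ ++ s) (β ++ t) (β′ ++ t)
            (nonzeroCodes-++⁺ {α} {α′} {s} {s} p ↭.refl) (nonzeroCodes-++⁺ {β} {β′} {t} {t} q ↭.refl))

  preserves-· : (∀ k → IsDerivation k) → ∀ f g → apply Φ (f · g) ≐ (apply Φ f ⊙ apply Φ g)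
  preserves-· derivation f g λ′ = begin
    apply Φ (f · g) λ′
      ≈⟨ apply-expand (f · g) λ′ ⟩
    expand (parts λ′) ((f · g) ∘ toPartition)
      ≈⟨ expand-cong (parts λ′) (λ s → trans (∑-boxes (parts (toPartition s)) H) (convolution-toPartition s H H-inv)) ⟩
    expandConvolution (parts λ′) H
      ≈⟨ expandConvolution≈expandSplits derivation (codes λ′) H H-inv ⟩
    expandSplits (parts λ′) H
      ≈⟨ ∑-cong (splits (parts λ′)) (λ p →
           trans (*-cong (apply-expand-toPartition f (proj₁ p)) (apply-expand-toPartition g (proj₂ p)))
           (expand-* (proj₁ p) (proj₂ p) (f ∘ toPartition) (g ∘ toPartition))) ⟨
    (apply Φ f ⊙ apply Φ g) λ′ ∎
    where
    H : List ℕ → List ℕ → Carrier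
    H α β = f (toPartition α) * g (toPartition β)
    H-inv : DependsOnPartitions H
    H-inv α α′ β β′ p q =
      *-cong (reflexive (≡.cong f (toPartition-cong α α′ p))) (reflexive (≡.cong g (toPartition-cong β β′ q)))

  dropZeros : ∀ H → DependsOnPartitions H →
              ∀ α β → H α β ≈ H (map suc (nonzeroCodes α)) (map suc (nonzeroCodes β))
  dropZeros H H-inv α β = H-inv α _ β _
    (↭.↭-reflexive (≡.sym (nonzeroCodes-map-suc (nonzeroCodes α))))
    (↭.↭-reflexive (≡.sym (nonzeroCodes-map-suc (nonzeroCodes β))))

  -- Set colorings

  Xbar-toPartition : ∀ G s →
    Xbar K G (toPartition s) ≈ coverSum (indepOfSize G) (χ ∘ isFull) (map suc (nonzeroCodes s))
  Xbar-toPartition G s = trans (setColoringCount≈coverSum G (toPartition s))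
    (coverSum-↭ (indepOfSize G) (χ ∘ isFull) (parts-toPartition s))

  partsOf-positive : ∀ os → map suc (nonzeroCodes (partsOf os)) ≡.≡ partsOf os
  partsOf-positive []       = ≡.refl
  partsOf-positive (o ∷ os) = ≡.trans (≡.cong (map suc) (nonzeroCodes-++ (newParts o) (partsOf os)))
    (≡.trans (map-++ suc (nonzeroCodes (newParts o)) (nonzeroCodes (partsOf os)))
             (≡.cong₂ _++_ (≡.cong (map suc) (nonzeroCodes-map-suc (proj₁ o))) (partsOf-positive os)))

  SubstitutesSetsAt : ∀ {m} → ℕ → (ℕ → List (Subset m)) → (ℕ → List (Subset m)) → Set (c ⊔ ℓ)
  SubstitutesSetsAt {m} k I J = ∀ (h : Subset m → Carrier) →
    ∑[ o ← rule k ] (coeff o * coverSum I h (newParts o)) ≈ ∑ (J (suc k)) h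

  expand-coverSum : ∀ {m} {I J : ℕ → List (Subset m)} → (∀ k → SubstitutesSetsAt k I J) →
    ∀ cds Ψ → expand (map suc cds) (coverSum I Ψ) ≈ coverSum J Ψ (map suc cds)
  expand-coverSum {I = I} substitutes [] Ψ = expand-[] (coverSum I Ψ)
  expand-coverSum {I = I} {J} substitutes (c ∷ cds) Ψ = begin
    expand (suc c ∷ ks) (coverSum I Ψ)
      ≈⟨ expand-∷ (suc c) ks (coverSum I Ψ) ⟩
    ∑[ o ← rule c ] (coeff o * expand ks (λ s → coverSum I Ψ (newParts o ++ s)))
      ≈⟨ ∑-cong (rule c) (λ o → *-congˡ (step o)) ⟩
    ∑[ o ← rule c ] (coeff o * coverSum I rest (newParts o))
      ≈⟨ substitutes c rest ⟩
    coverSum J Ψ (suc c ∷ ks) ∎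
    where
    ks = map suc cds
    rest : Subset _ → Carrier
    rest W = coverSum J (λ W′ → Ψ (W ∪ W′)) ks
    step : ∀ o → expand ks (λ s → coverSum I Ψ (newParts o ++ s)) ≈ coverSum I rest (newParts o)
    step o = begin
      expand ks (λ s → coverSum I Ψ (newParts o ++ s))
        ≈⟨ expand-cong ks (λ s → coverSum-++ I Ψ (newParts o) s) ⟩
      expand ks (λ s → ∑×[ Ts ← map I (newParts o) ] coverSum I (λ W′ → Ψ (⋃ Ts ∪ W′)) s)
        ≈⟨ expand-∑× ks (map I (newParts o)) (λ s Ts → coverSum I (λ W′ → Ψ (⋃ Ts ∪ W′)) s) ⟩
      ∑×[ Ts ← map I (newParts o) ] expand ks (coverSum I (λ W′ → Ψ (⋃ Ts ∪ W′)))
        ≈⟨ ∑×-cong (map I (newParts o)) (λ Ts → expand-coverSum substitutes cds (λ W′ → Ψ (⋃ Ts ∪ W′))) ⟩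
      coverSum I rest (newParts o) ∎

  apply-Xbar : ∀ G → (∀ k → SubstitutesSetsAt k (indepOfSize G) (indepOfSize (complement G))) →
    apply Φ (Xbar K G) ≐ Xbar K (complement G)
  apply-Xbar G substitutes λ′ = begin
    apply Φ (Xbar K G) λ′
      ≈⟨ apply-expand (Xbar K G) λ′ ⟩
    expand (parts λ′) (Xbar K G ∘ toPartition)
      ≈⟨ ∑×-cong (map options (parts λ′)) (λ os → *-congˡ (trans (Xbar-toPartition G (partsOf os))
           (reflexive (≡.cong (coverSum (indepOfSize G) (χ ∘ isFull)) (partsOf-positive os))))) ⟩
    expand (parts λ′) (coverSum (indepOfSize G) (χ ∘ isFull))
      ≈⟨ expand-coverSum substitutes (codes λ′) (χ ∘ isFull) ⟩
    coverSum (indepOfSize (complement G)) (χ ∘ isFull) (parts λ′)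
      ≈⟨ setColoringCount≈coverSum (complement G) λ′ ⟨
    Xbar K (complement G) λ′ ∎

module Proposition {c ℓ : Level} (K : CharZeroField c ℓ) where

  open CharZeroField K
  open SymFun K
  open ListSums commRing
  open SubsetSums commRing
  open CoverSums commRing
  open import Relation.Binary.Reasoning.Setoid setoid
  open import Algebra.Solver.Ring.NaturalCoefficients.Default commutativeSemiring

  ½ : Carrier
  ½ = (ringFromℕ commRing 2 ⁻¹) (charZero 1)

  ½+½≈1 : ½ + ½ ≈ 1#
  ½+½≈1 = trans (solve 1 (λ h → h :+ h := h :* (con 1 :+ (con 1 :+ con 0))) refl ½) (inverseˡ _ (charZero 1))

  ½+½-1≈0 : (½ + ½) + - 1# ≈ 0#
  ½+½-1≈0 = trans (+-congʳ ½+½≈1) (-‿inverseʳ 1#)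

  -- In terms of parts: a part 1 is kept, and a part 2 is replaced by (1,1), (1)
  -- and (2) with weights ½, −½ and −1.
  rule : ℕ → List (List ℕ × Carrier)
  rule 0             = ((0 ∷ []) , 1#) ∷ []
  rule 1             = ((0 ∷ 0 ∷ []) , ½) ∷ ((0 ∷ []) , - ½) ∷ ((1 ∷ []) , - 1#) ∷ []
  rule (suc (suc _)) = []

  open PartSubstitution K rule

  rule-nonempty : ∀ k → All (λ o → proj₁ o ≢ []) (rule k)
  rule-nonempty 0             = (λ ()) ∷ []
  rule-nonempty 1             = (λ ()) ∷ (λ ()) ∷ (λ ()) ∷ []
  rule-nonempty (suc (suc _)) = []

  rule-derivation : ∀ k → IsDerivation k
  rule-derivation k Q Q-inv =
    trans (∑-cong (rule k) (λ o → *-congˡ (convolution-cong (newParts o) (dropZeros Q Q-inv)))) (derivation k)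
    where
    Q̂ : List ℕ → List ℕ → Carrier
    Q̂ α β = Q (map suc (nonzeroCodes α)) (map suc (nonzeroCodes β))
    derivation : ∀ k → ∑[ o ← rule k ] (coeff o * convolution Q̂ (newParts o)) ≈
                       ∑[ o ← rule k ] (coeff o * Q (newParts o) []) + ∑[ o ← rule k ] (coeff o * Q [] (newParts o))
    derivation 0 = solve 2 (λ a b → con 1 :* (b :+ (a :+ con 0)) :+ con 0
                                    := (con 1 :* a :+ con 0) :+ (con 1 :* b :+ con 0))
                     refl (Q (1 ∷ []) []) (Q [] (1 ∷ []))
    -- The mixed terms, all equal to Q (1) (1), come with total weight ½ + ½ − 1.
    derivation 1 = trans
      (solve 10 (λ h nh n1 a b g d e f M →
            h :* ((d :+ (M :+ con 0)) :+ ((M :+ (a :+ con 0)) :+ con 0))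
         :+ (nh :* (e :+ (b :+ con 0)) :+ (n1 :* (f :+ (M :+ (g :+ con 0))) :+ con 0))
         := ((h :* a :+ (nh :* b :+ (n1 :* g :+ con 0))) :+ (h :* d :+ (nh :* e :+ (n1 :* f :+ con 0))))
         :+ ((h :+ h) :+ n1) :* M)
         refl ½ (- ½) (- 1#)
         (Q (1 ∷ 1 ∷ []) []) (Q (1 ∷ []) []) (Q (2 ∷ []) []) (Q [] (1 ∷ 1 ∷ [])) (Q [] (1 ∷ [])) (Q [] (2 ∷ []))
         (Q (1 ∷ []) (1 ∷ [])))
      (trans (+-congˡ (trans (*-congʳ ½+½-1≈0) (zeroˡ _))) (+-identityʳ _))
    derivation (suc (suc _)) = sym (+-identityʳ 0#)

  substitutes-singletons : ∀ G → SubstitutesSetsAt 0 (indepOfSize G) (indepOfSize (complement G))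
  substitutes-singletons G h = begin
    1# * ∑[ S ← indepOfSize G 1 ] h (S ∪ ⊥) + 0#
      ≈⟨ trans (+-identityʳ _) (*-identityˡ _) ⟩
    ∑[ S ← indepOfSize G 1 ] h (S ∪ ⊥)
      ≈⟨ ∑-cong (indepOfSize G 1) (λ S → reflexive (≡.cong h (∪-identityʳ S))) ⟩
    ∑ (indepOfSize G 1) h
      ≈⟨ ∑-indepOfSize-1 G h ⟩
    ∑[ S ← allSubsets (n G) ] (χ (ofSize 1 S) * h S)
      ≈⟨ ∑-indepOfSize-1 (complement G) h ⟨
    ∑ (indepOfSize (complement G) 1) h ∎

  substitutes-pairs : ∀ G → SubstitutesSetsAt 1 (indepOfSize G) (indepOfSize (complement G))
  substitutes-pairs G h = begin
    ½ * ∑[ S ← I₁ ] ∑[ T ← I₁ ] h (S ∪ (T ∪ ⊥)) +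
    (- ½ * ∑[ S ← I₁ ] h (S ∪ ⊥) + (- 1# * ∑[ S ← I₂ ] h (S ∪ ⊥) + 0#))
      ≈⟨ +-cong (*-congˡ ordered-pairs) (+-cong (*-congˡ singletons) (+-congʳ (*-congˡ independent-pairs))) ⟩
    ½ * (a + (b + b)) + (- ½ * a + (- 1# * g + 0#))
      ≈⟨ +-congʳ (*-congˡ (+-congˡ (+-cong b≈g+g′ b≈g+g′))) ⟩
    ½ * (a + ((g + g′) + (g + g′))) + (- ½ * a + (- 1# * g + 0#))
      ≈⟨ solve 6 (λ h nh n1 a g g′ → h :* (a :+ ((g :+ g′) :+ (g :+ g′))) :+ (nh :* a :+ (n1 :* g :+ con 0))
                                     := (h :+ nh) :* a :+ ((h :+ h) :* g′ :+ ((h :+ h) :+ n1) :* g))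
               refl ½ (- ½) (- 1#) a g g′ ⟩
    (½ + - ½) * a + ((½ + ½) * g′ + ((½ + ½) + - 1#) * g)
      ≈⟨ +-cong (*-congʳ (-‿inverseʳ ½)) (+-cong (*-congʳ ½+½≈1) (*-congʳ ½+½-1≈0)) ⟩
    0# * a + (1# * g′ + 0# * g)
      ≈⟨ solve 3 (λ a g g′ → con 0 :* a :+ (con 1 :* g′ :+ con 0 :* g) := g′) refl a g g′ ⟩
    g′
      ≈⟨ ∑-indepOfSize (complement G) 2 h ⟨
    ∑ (indepOfSize (complement G) 2) h ∎
    where
    I₁ = indepOfSize G 1
    I₂ = indepOfSize G 2
    subsets = allSubsets (n G)
    a b g g′ : Carrier
    a  = ∑[ S ← subsets ] (χ (ofSize 1 S) * h S)
    b  = ∑[ S ← subsets ] (χ (ofSize 2 S) * h S)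
    g  = ∑[ S ← subsets ] (χ (isIndependent G S ∧ ofSize 2 S) * h S)
    g′ = ∑[ S ← subsets ] (χ (isIndependent (complement G) S ∧ ofSize 2 S) * h S)
    ordered-pairs : ∑[ S ← I₁ ] ∑[ T ← I₁ ] h (S ∪ (T ∪ ⊥)) ≈ a + (b + b)
    ordered-pairs = begin
      ∑[ S ← I₁ ] ∑[ T ← I₁ ] h (S ∪ (T ∪ ⊥))
        ≈⟨ ∑-cong I₁ (λ S → ∑-cong I₁ (λ T → reflexive (≡.cong (λ W → h (S ∪ W)) (∪-identityʳ T)))) ⟩
      ∑[ S ← I₁ ] ∑[ T ← I₁ ] h (S ∪ T)
        ≈⟨ ∑-indepOfSize-1 G (λ S → ∑[ T ← I₁ ] h (S ∪ T)) ⟩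
      ∑[ S ← subsets ] (χ (ofSize 1 S) * ∑[ T ← I₁ ] h (S ∪ T))
        ≈⟨ ∑-cong subsets (λ S → *-congˡ (∑-indepOfSize-1 G (λ T → h (S ∪ T)))) ⟩
      ∑[ S ← subsets ] (χ (ofSize 1 S) * ∑[ T ← subsets ] (χ (ofSize 1 T) * h (S ∪ T)))
        ≈⟨ ∑-singleton-pairs (n G) h ⟩
      a + (b + b) ∎
    singletons : ∑[ S ← I₁ ] h (S ∪ ⊥) ≈ a
    singletons = trans (∑-cong I₁ (λ S → reflexive (≡.cong h (∪-identityʳ S)))) (∑-indepOfSize-1 G h)
    independent-pairs : ∑[ S ← I₂ ] h (S ∪ ⊥) ≈ g
    independent-pairs = trans (∑-cong I₂ (λ S → reflexive (≡.cong h (∪-identityʳ S)))) (∑-indepOfSize G 2 h)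
    b≈g+g′ : b ≈ g + g′
    b≈g+g′ = sym (trans (sym (∑-distrib-+ subsets _ _))
      (∑-cong subsets (λ S → trans (sym (distribʳ (h S) _ _)) (*-congʳ (χ-pair G S)))))

  substitutes-large : ∀ G → TriangleFree G → ∀ r →
                      SubstitutesSetsAt (suc (suc r)) (indepOfSize G) (indepOfSize (complement G))
  substitutes-large G triangleFree r h = begin
    0#
      ≈⟨ ∑-0 (allSubsets (n G)) ⟨
    ∑[ S ← allSubsets (n G) ] 0#
      ≈⟨ ∑-cong (allSubsets (n G)) (λ S →
           trans (*-congʳ (reflexive (≡.cong χ (no-triangles S)))) (zeroˡ (h S))) ⟨
    ∑[ S ← allSubsets (n G) ] (χ (isIndependent (complement G) S ∧ ofSize (suc (suc (suc r))) S) * h S)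
      ≈⟨ ∑-indepOfSize (complement G) (suc (suc (suc r))) h ⟨
    ∑ (indepOfSize (complement G) (suc (suc (suc r)))) h ∎
    where
    no-triangles : ∀ S → isIndependent (complement G) S ∧ ofSize (suc (suc (suc r))) S ≡.≡ false
    no-triangles S with ofSize (suc (suc (suc r))) S in e
    ... | true  rewrite triangleFree⇒size>2⇒dependent-complement G triangleFree r S
                          (ofSize⇒size≡ (suc (suc (suc r))) S e) = ≡.refl
    ... | false = ∧-zeroʳ _

  rule-substitutes : ∀ G → TriangleFree G → ∀ k → SubstitutesSetsAt k (indepOfSize G) (indepOfSize (complement G))
  rule-substitutes G triangleFree 0             = substitutes-singletons G
  rule-substitutes G triangleFree 1             = substitutes-pairs G
  rule-substitutes G triangleFree (suc (suc r)) = substitutes-large G triangleFree r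

  Φ-isHopfMorphism : IsHopfMorphism Φ
  Φ-isHopfMorphism = record
    { preserves-· = preserves-· rule-derivation
    ; preserves-1 = preserves-1 rule-nonempty
    ; preserves-Δ = preserves-Δ
    ; preserves-ε = preserves-ε
    }

  Φ-Xbar : ∀ G → TriangleFree G → apply Φ (Xbar K G) ≐ Xbar K (complement G)
  Φ-Xbar G triangleFree = apply-Xbar G (rule-substitutes G triangleFree)

proposition8p6 : {c ℓ : Level} (K : CharZeroField c ℓ) →
    let open SymFun K in
    Σ ContLinMap (λ Φ →
      IsHopfMorphism Φ ×
      ((G : Graph) → TriangleFree G →
        apply Φ (Xbar K G) ≐ Xbar K (complement G)))
proposition8p6 K = Φ , Φ-isHopfMorphism , Φ-Xbar
  where
  open Proposition K
  open PartSubstitution K rule using (Φ)
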